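{- For any finite simple graph $H$ and any edge $e\in E(H)$ we have $$\frac{\mathrm{wr}(H)}{\mathrm{wr}(H-e)}\geq\frac{7}{9}.$$
   Context: $\mathrm{wr}(H)$ denotes the number of Widom-Rowlinson configurations of $H$: the number of maps $\phi:V(H)\to\{a,b,c\}$ (colors red, white, blue respectively) such that no edge of $H$ has one endpoint colored $a$ and the other colored $c$. Equivalently, $\mathrm{wr}(H)$ is the number of homomorphisms from $H$ to the graph $P_3^{\circ}$, the path $a-b-c$ on three vertices with a loop added at each vertex. $H-e$ is the graph with vertex set $V(H)$ and edge set $E(H)\setminus\{e\}$. -}

module Defs where

open import Data.Nat using (ℕ; zero; suc)
open import Data.Fin using (Fin; zero; suc; _≟_)
open import Data.Bool using (Bool; true; false; _∧_; _∨_; not; if_then_else_)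
open import Data.List using (List; []; _∷_; map; concatMap; length; filter; allFin; foldr)
open import Data.Product using (_×_; _,_)
open import Relation.Binary.PropositionalEquality using (_≡_)
open import Relation.Nullary.Decidable using (⌊_⌋)
open import Relation.Nullary using (¬_)

record SimpleGraph (n : ℕ) : Set where
  field
    adj   : Fin n → Fin n → Bool
    sym   : ∀ u v → adj u v ≡ adj v u
    loopless : ∀ v → adj v v ≡ false
open SimpleGraph public

-- An edge of H: an ordered pair of adjacent vertices (representing {u , v}).
record Edge {n : ℕ} (H : SimpleGraph n) : Set where
  constructor edge
  field
    u v : Fin n
    adjacent : adj H u v ≡ true
open Edge public

samePair : ∀ {n} → Fin n → Fin n → Fin n → Fin n → Bool
samePair u v x y = (⌊ x ≟ u ⌋ ∧ ⌊ y ≟ v ⌋) ∨ (⌊ x ≟ v ⌋ ∧ ⌊ y ≟ u ⌋)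

delAdj : ∀ {n} (H : SimpleGraph n) → Edge H → Fin n → Fin n → Bool
delAdj H e x y = adj H x y ∧ not (samePair (u e) (v e) x y)

-- Colours: zero = a (red), suc zero = b (white), suc (suc zero) = c (blue).
Colour : Set
Colour = Fin 3

-- Adjacency in P₃° (path a - b - c with loops): only a,c and c,a are non-adjacent.
P3°-adj : Colour → Colour → Bool
P3°-adj zero (suc (suc zero)) = false
P3°-adj (suc (suc zero)) zero = false
P3°-adj _ _ = true

allMaps : (n : ℕ) → List (Fin n → Colour)
allMaps zero = (λ ()) ∷ []
allMaps (suc n) =
  concatMap (λ c → map (λ f → λ { zero → c ; (suc i) → f i }) (allMaps n)) (allFin 3)

all : ∀ {A : Set} → (A → Bool) → List A → Bool
all p = foldr (λ x b → p x ∧ b) true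

-- φ is a Widom–Rowlinson configuration (homomorphism to P₃°) for adjacency relation A
isWR : ∀ {n} → (Fin n → Fin n → Bool) → (Fin n → Colour) → Bool
isWR {n} A φ =
  all (λ x → all (λ y → not (A x y) ∨ P3°-adj (φ x) (φ y)) (allFin n)) (allFin n)

wrAdj : ∀ {n} → (Fin n → Fin n → Bool) → ℕ
wrAdj {n} A = length (filter (λ φ → isWR A φ ≡? true) (allMaps n))
  where
  open import Data.Bool.Properties using () renaming (_≟_ to _≡?_)

wr : ∀ {n} → SimpleGraph n → ℕ
wr H = wrAdj (adj H)

wr-minus : ∀ {n} (H : SimpleGraph n) → Edge H → ℕ
wr-minus H e = wrAdj (delAdj H e)

module Submission where

-- For an edge e = uv of a simple graph H we compare valid(H − e) and valid(H) by sorting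
-- the configurations φ of H − e into nine classes by the pair (φ u , φ v); write
-- XY for the size of a class, X, Y ∈ {R(ed), W(hite), B(lue)}.  The configurations
-- of H are exactly those outside RB and BR.  Three injections between classes give
--   * whitening v:  RB ≤ RW, BR ≤ BW, WB ≤ WW, WR ≤ WW;
--   * whitening u:  RB ≤ WB, BR ≤ WR;
--   * a Kempe chain: exchanging red and blue on the set of vertices reachable from v
--     through non-white vertices gives RB ≤ RR and BR ≤ BB.
-- Hence 7 (RB + BR) ≤ 2 valid(H), which is 7 valid(H − e) ≤ 9 valid(H).

open import Defs hiding (sym; all)
import Defs

import Algebra.Properties.CommutativeSemigroup as CommutativeSemigroupProperties
open import Data.Bool using (Bool; true; false; _∧_; _∨_; not)
open import Data.Bool.Properties using () renaming (_≟_ to _≟ᵇ_)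
open import Data.Empty using (⊥-elim)
open import Data.Fin using (Fin; zero; suc; _≟_)
open import Data.Fin.Properties using (injective⇒≤; any?)
open import Data.Fin.Subset using (Subset; ⁅_⁆; _∪_; _∩_; _⊆_; _⊂_; ∣_∣)
  renaming (_∈_ to _∈ₛ_; _∉_ to _∉ₛ_)
open import Data.Fin.Subset.Properties
  using ( _∈?_; _⊂?_; ⊆-antisym; ∣p∣≤n; p⊂q⇒∣p∣<∣q∣; p⊆p∪q
        ; x∈p∪q⁺; x∈p∪q⁻; x∈p∩q⁺; x∈p∩q⁻; x∈⁅x⁆; x∈⁅y⁆⇒x≡y)
open import Data.List using (List; []; _∷_; length; lookup; filter; map; concatMap; allFin)
open import Data.List.Properties using (map-cong)
open import Data.List.Membership.Propositional using () renaming (_∈_ to _∈≡_)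
open import Data.List.Membership.Propositional.Properties using (∈-allFin)
import Data.List.Membership.Setoid as SetoidMembership
open import Data.List.Membership.Setoid.Properties
  using (∈-resp-≋; ∈-map⁻; ∈-lookup; index-injective; ∈-filter⁺; ∈-filter⁻; ∈-resp-≈)
open import Data.List.Relation.Binary.Disjoint.Setoid using (Disjoint)
import Data.List.Relation.Binary.Equality.Setoid as ListEquality
open import Data.List.Relation.Binary.Permutation.Setoid using (↭-reflexive-≋)
open import Data.List.Relation.Binary.Permutation.Setoid.Properties using (Unique-resp-↭)
import Data.List.Relation.Binary.Pointwise as Pointwise
import Data.List.Relation.Binary.Pointwise.Properties as PointwiseProperties
import Data.List.Relation.Unary.All as All
import Data.List.Relation.Unary.All.Properties as AllProperties
import Data.List.Relation.Unary.AllPairs as AllPairs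
open import Data.List.Relation.Unary.AllPairs using ([]; _∷_)
import Data.List.Relation.Unary.AllPairs.Properties as AllPairsProperties
open import Data.List.Relation.Unary.Any as Any using (here; there)
import Data.List.Relation.Unary.Any.Properties as AnyProperties
open import Data.List.Relation.Unary.Unique.Propositional using () renaming (Unique to Unique≡)
open import Data.List.Relation.Unary.Unique.Propositional.Properties using (allFin⁺)
import Data.List.Relation.Unary.Unique.Setoid as SetoidUnique
import Data.List.Relation.Unary.Unique.Setoid.Properties as UniqueProperties
open import Data.Nat using (ℕ; zero; suc; _+_; _*_; _≤_; _<_; s≤s)
open import Data.Nat.ListAction using (sum)
open import Data.Nat.Properties
  using ( +-commutativeSemigroup; <⇒≱; <-≤-trans; +-monoʳ-<; m≤m+n; *-distribˡ-+; *-distribʳ-+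
        ; +-monoˡ-≤; +-mono-≤; *-monoʳ-≤; ≤-trans; module ≤-Reasoning)
open import Data.Nat.Tactic.RingSolver using (solve-∀)
open import Data.Product using (_×_; _,_; ∃; proj₁; proj₂)
open import Data.Sum using (_⊎_; inj₁; inj₂)
open import Data.Vec using (tabulate)
open import Data.Vec.Properties using (tabulate-cong; lookup∘tabulate; lookup⇒[]=; []=⇒lookup)
open import Function.Base using (_∘_; id)
open import Function.Bundles using (_⇔_; mk⇔; Equivalence)
open import Function.Definitions using (Injective)
open import Level using (0ℓ)
open import Relation.Binary.Bundles using (Setoid)
open import Relation.Binary.Definitions using (_Respects_)
open import Relation.Binary.PropositionalEquality
  using (_→-setoid_; _≡_; _≢_; refl; sym; trans; cong; cong₂; subst; subst₂; module ≡-Reasoning)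
open import Relation.Nullary.Decidable using (Dec; does; does-⇔; yes; no; dec-true; ¬?; _×-dec_; _⊎-dec_)
open import Relation.Nullary.Negation using (¬_)
open import Relation.Unary using (Pred; Decidable)


count : ∀ {a p} {A : Set a} {P : Pred A p} → Decidable P → List A → ℕ
count P? xs = length (filter P? xs)

indicator : Bool → ℕ
indicator true  = 1
indicator false = 0

count-∷ : ∀ {a p} {A : Set a} {P : Pred A p} (P? : Decidable P) x xs →
  count P? (x ∷ xs) ≡ indicator (does (P? x)) + count P? xs
count-∷ P? x xs with does (P? x)
... | true  = refl
... | false = refl

sum-map-+ : ∀ {k} {K : Set k} (f g : K → ℕ) (ks : List K) →
  sum (map (λ i → f i + g i) ks) ≡ sum (map f ks) + sum (map g ks)
sum-map-+ f g []       = refl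
sum-map-+ f g (i ∷ ks) =
  trans (cong (f i + g i +_) (sum-map-+ f g ks)) (interchange (f i) (g i) _ _)
  where open CommutativeSemigroupProperties +-commutativeSemigroup using (interchange)

count-partition : ∀ {a p k q} {A : Set a} {P : Pred A p} {K : Set k} {Q : K → Pred A q}
  (P? : Decidable P) (ks : List K) (Q? : ∀ i → Decidable (Q i)) →
  (∀ x → indicator (does (P? x)) ≡ sum (map (λ i → indicator (does (Q? i x))) ks)) →
  ∀ xs → count P? xs ≡ sum (map (λ i → count (Q? i) xs) ks)
count-partition P? ks Q? pointwise [] = sym (zeros ks)
  where
  zeros : ∀ ks → sum (map (λ i → count (Q? i) []) ks) ≡ 0
  zeros []       = refl
  zeros (_ ∷ ks) = zeros ks
count-partition P? ks Q? pointwise (x ∷ xs) = begin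
  count P? (x ∷ xs)
    ≡⟨ count-∷ P? x xs ⟩
  indicator (does (P? x)) + count P? xs
    ≡⟨ cong₂ _+_ (pointwise x) (count-partition P? ks Q? pointwise xs) ⟩
  sum (map (λ i → indicator (does (Q? i x))) ks) + sum (map (λ i → count (Q? i) xs) ks)
    ≡⟨ sum-map-+ _ _ ks ⟨
  sum (map (λ i → indicator (does (Q? i x)) + count (Q? i) xs) ks)
    ≡⟨ cong sum (map-cong (λ i → sym (count-∷ (Q? i) x xs)) ks) ⟩
  sum (map (λ i → count (Q? i) (x ∷ xs)) ks) ∎
  where open ≡-Reasoning

module Counting {a ℓ} (S : Setoid a ℓ) where
  open Setoid S using (_≈_) renaming (Carrier to A; sym to ≈-sym)
  open SetoidMembership S using (_∈_)
  open SetoidUnique S using (Unique)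

  lookup-injective : ∀ {xs} → Unique xs → ∀ i j → lookup xs i ≈ lookup xs j → i ≡ j
  lookup-injective {x ∷ xs} _         zero    zero    _   = refl
  lookup-injective {x ∷ xs} xs!       zero    (suc j) x≈  =
    ⊥-elim (UniqueProperties.Unique[x∷xs]⇒x∉xs S xs! (∈-resp-≈ S (≈-sym x≈) (∈-lookup S xs j)))
  lookup-injective {x ∷ xs} xs!       (suc i) zero    ≈x  =
    ⊥-elim (UniqueProperties.Unique[x∷xs]⇒x∉xs S xs! (∈-resp-≈ S ≈x (∈-lookup S xs i)))
  lookup-injective {x ∷ xs} (_ ∷ xs!) (suc i) (suc j) i≈j = cong suc (lookup-injective xs! i j i≈j)

  injection-length-≤ : ∀ {xs ys} (f : A → A) → Unique xs →
    (∀ {x} → x ∈ xs → f x ∈ ys) →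
    (∀ {x y} → x ∈ xs → y ∈ xs → f x ≈ f y → x ≈ y) →
    length xs ≤ length ys
  injection-length-≤ {xs} {ys} f xs! into inj = injective⇒≤ position-injective
    where
    position : Fin (length xs) → Fin (length ys)
    position i = Any.index (into (∈-lookup S xs i))

    position-injective : Injective _≡_ _≡_ position
    position-injective {i} {j} eq =
      lookup-injective xs! i j
        (inj (∈-lookup S xs i) (∈-lookup S xs j) (index-injective S (into _) (into _) eq))

  count-≤-by-injection : ∀ {xs} → Unique xs → (∀ x → x ∈ xs) →
    ∀ {p} {P Q : Pred A p} (P? : Decidable P) (Q? : Decidable Q) →
    P Respects _≈_ → Q Respects _≈_ → (f : A → A) →
    (∀ {x} → P x → Q (f x)) →
    (∀ {x y} → P x → P y → f x ≈ f y → x ≈ y) →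
    count P? xs ≤ count Q? xs
  count-≤-by-injection {xs} xs! enumerates {P = P} P? Q? P-resp Q-resp f maps inj =
    injection-length-≤ f (UniqueProperties.filter⁺ S P? xs!)
      (λ x∈ → ∈-filter⁺ S Q? Q-resp (enumerates (f _)) (maps (satisfies x∈)))
      (λ x∈ y∈ → inj (satisfies x∈) (satisfies y∈))
    where
    satisfies : ∀ {x} → x ∈ filter P? xs → P x
    satisfies x∈ = proj₂ (∈-filter⁻ S P? P-resp {xs = xs} x∈)

maps : ℕ → Set → Setoid 0ℓ 0ℓ
maps n B = Fin n →-setoid B

module Extensions {n : ℕ} {B : Set} where

  open SetoidMembership (maps n B) using () renaming (_∈_ to _∈ₙ_)
  open SetoidMembership (maps (suc n) B) using () renaming (_∈_ to _∈₁₊ₙ_)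

  prepend : B → (Fin n → B) → Fin (suc n) → B
  prepend c φ zero    = c
  prepend c φ (suc i) = φ i

  extensions : List B → List (Fin n → B) → List (Fin (suc n) → B)
  extensions cs L = concatMap (λ c → map (prepend c) L) cs

  ≈-prepend : ∀ {φ : Fin (suc n) → B} {c ψ} → φ zero ≡ c → (∀ i → φ (suc i) ≡ ψ i) →
    ∀ i → φ i ≡ prepend c ψ i
  ≈-prepend head _    zero    = head
  ≈-prepend _    tail (suc i) = tail i

  prepend-injective : ∀ {c φ ψ} → (∀ i → prepend c φ i ≡ prepend c ψ i) → ∀ i → φ i ≡ ψ i
  prepend-injective eq = eq ∘ suc

  extensions-complete : ∀ {cs L} → (∀ c → c ∈≡ cs) → (∀ ψ → ψ ∈ₙ L) →
    ∀ φ → φ ∈₁₊ₙ extensions cs L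
  extensions-complete {cs} {L} cs-complete L-complete φ =
    AnyProperties.concat⁺ (AnyProperties.map⁺ (Any.map extend (cs-complete (φ zero))))
    where
    extend : ∀ {c} → φ zero ≡ c → φ ∈₁₊ₙ map (prepend c) L
    extend head = AnyProperties.map⁺ (Any.map (≈-prepend head) (L-complete (φ ∘ suc)))

  extensions-unique : ∀ {cs L} → Unique≡ cs → SetoidUnique.Unique (maps n B) L →
    SetoidUnique.Unique (maps (suc n) B) (extensions cs L)
  extensions-unique {cs} {L} cs! L! =
    UniqueProperties.concat⁺ (maps (suc n) B)
      (AllProperties.map⁺ (All.universal (λ _ → same-head-unique) cs))
      (AllPairsProperties.map⁺ (AllPairs.map different-heads-disjoint cs!))
    where
    same-head-unique : ∀ {c} → SetoidUnique.Unique (maps (suc n) B) (map (prepend c) L)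
    same-head-unique = UniqueProperties.map⁺ (maps n B) (maps (suc n) B) prepend-injective L!

    different-heads-disjoint : ∀ {c d} → c ≢ d →
      Disjoint (maps (suc n) B) (map (prepend c) L) (map (prepend d) L)
    different-heads-disjoint c≢d (φ∈c , φ∈d)
      with ∈-map⁻ (maps n B) (maps (suc n) B) φ∈c | ∈-map⁻ (maps n B) (maps (suc n) B) φ∈d
    ... | _ , _ , φ≈ | _ , _ , φ≈′ = c≢d (trans (sym (φ≈ zero)) (φ≈′ zero))

open Extensions using (prepend; extensions)

-- The extensions of allMaps n agree entry by entry with allMaps (suc n), whose
-- prepending functions are pointwise equal to prepend.
extensions-allMaps : ∀ n →
  ListEquality._≋_ (maps (suc n) Colour) (extensions (allFin 3) (allMaps n)) (allMaps (suc n))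
extensions-allMaps n =
  Pointwise.++⁺ (agree zero (λ _ → refl) (λ _ _ → refl))
    (Pointwise.++⁺ (agree (suc zero) (λ _ → refl) (λ _ _ → refl))
      (Pointwise.++⁺ (agree (suc (suc zero)) (λ _ → refl) (λ _ _ → refl)) Pointwise.[]))
  where
  agree : ∀ c {g : (Fin n → Colour) → Fin (suc n) → Colour} →
    (∀ φ → g φ zero ≡ c) → (∀ φ i → g φ (suc i) ≡ φ i) →
    ListEquality._≋_ (maps (suc n) Colour) (map (prepend c) (allMaps n)) (map g (allMaps n))
  agree c {g} head tail = Pointwise.map⁺ (prepend c) g
    (PointwiseProperties.refl (λ {φ} i → sym (Extensions.≈-prepend {φ = g φ} (head φ) (tail φ) i)))

allMaps-complete : ∀ n (φ : Fin n → Colour) → SetoidMembership._∈_ (maps n Colour) φ (allMaps n)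
allMaps-complete zero    φ = here (λ ())
allMaps-complete (suc n) φ =
  ∈-resp-≋ (maps (suc n) Colour) (extensions-allMaps n)
    (Extensions.extensions-complete ∈-allFin (allMaps-complete n) φ)

allMaps-unique : ∀ n → SetoidUnique.Unique (maps n Colour) (allMaps n)
allMaps-unique zero    = All.[] ∷ []
allMaps-unique (suc n) =
  Unique-resp-↭ (maps (suc n) Colour) (↭-reflexive-≋ (maps (suc n) Colour) (extensions-allMaps n))
    (Extensions.extensions-unique (allFin⁺ 3) (allMaps-unique n))

red white blue : Colour
red   = zero
white = suc zero
blue  = suc (suc zero)

P₃°-sym : ∀ c d → P3°-adj c d ≡ P3°-adj d c
P₃°-sym zero             zero             = refl
P₃°-sym zero             (suc zero)       = refl
P₃°-sym zero             (suc (suc zero)) = refl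
P₃°-sym (suc zero)       zero             = refl
P₃°-sym (suc zero)       (suc zero)       = refl
P₃°-sym (suc zero)       (suc (suc zero)) = refl
P₃°-sym (suc (suc zero)) zero             = refl
P₃°-sym (suc (suc zero)) (suc zero)       = refl
P₃°-sym (suc (suc zero)) (suc (suc zero)) = refl

white-adjacent : ∀ c → P3°-adj white c ≡ true
white-adjacent zero             = refl
white-adjacent (suc zero)       = refl
white-adjacent (suc (suc zero)) = refl

adjacent-white : ∀ c → P3°-adj c white ≡ true
adjacent-white c = trans (P₃°-sym c white) (white-adjacent c)

-- Adjacent non-white colours coincide, since red and blue are not adjacent.
nonwhite-adjacent : ∀ {c d} → c ≢ white → d ≢ white → P3°-adj c d ≡ true → c ≡ d
nonwhite-adjacent {zero}           {zero}           _   _   _ = refl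
nonwhite-adjacent {suc (suc zero)} {suc (suc zero)} _   _   _ = refl
nonwhite-adjacent {suc zero}       {_}              c≢w _   _ = ⊥-elim (c≢w refl)
nonwhite-adjacent {_}              {suc zero}       _   d≢w _ = ⊥-elim (d≢w refl)
nonwhite-adjacent {zero}           {suc (suc zero)} _   _   ()
nonwhite-adjacent {suc (suc zero)} {zero}           _   _   ()

mirror : Colour → Colour
mirror zero             = blue
mirror (suc zero)       = white
mirror (suc (suc zero)) = red

mirror-involutive : ∀ c → mirror (mirror c) ≡ c
mirror-involutive zero             = refl
mirror-involutive (suc zero)       = refl
mirror-involutive (suc (suc zero)) = refl

mirror-white : ∀ c → (mirror c ≡ white) ⇔ (c ≡ white)
mirror-white zero             = mk⇔ (λ ()) (λ ())
mirror-white (suc zero)       = mk⇔ (λ _ → refl) (λ _ → refl)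
mirror-white (suc (suc zero)) = mk⇔ (λ ()) (λ ())

P₃°-mirror : ∀ c d → P3°-adj (mirror c) (mirror d) ≡ P3°-adj c d
P₃°-mirror zero             zero             = refl
P₃°-mirror zero             (suc zero)       = refl
P₃°-mirror zero             (suc (suc zero)) = refl
P₃°-mirror (suc zero)       zero             = refl
P₃°-mirror (suc zero)       (suc zero)       = refl
P₃°-mirror (suc zero)       (suc (suc zero)) = refl
P₃°-mirror (suc (suc zero)) zero             = refl
P₃°-mirror (suc (suc zero)) (suc zero)       = refl
P₃°-mirror (suc (suc zero)) (suc (suc zero)) = refl

IsWR : ∀ {n} → (Fin n → Fin n → Bool) → (Fin n → Colour) → Set
IsWR A φ = ∀ x y → A x y ≡ true → P3°-adj (φ x) (φ y) ≡ true

∧-true : ∀ {a b} → a ∧ b ≡ true → a ≡ true × b ≡ true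
∧-true {true} b≡true = refl , b≡true

all-sound : ∀ {A : Set} (p : A → Bool) xs → Defs.all p xs ≡ true → ∀ {x} → x ∈≡ xs → p x ≡ true
all-sound p (y ∷ xs) all≡true (here refl) = proj₁ (∧-true all≡true)
all-sound p (y ∷ xs) all≡true (there x∈)  = all-sound p xs (proj₂ (∧-true {p y} all≡true)) x∈

all-complete : ∀ {A : Set} (p : A → Bool) xs → (∀ x → p x ≡ true) → Defs.all p xs ≡ true
all-complete p []       _      = refl
all-complete p (y ∷ xs) p-true rewrite p-true y = all-complete p xs p-true

isWR-sound : ∀ {n} A (φ : Fin n → Colour) → isWR A φ ≡ true → IsWR A φ
isWR-sound A φ valid x y Axy with A x y | all-sound _ _ (all-sound _ _ valid (∈-allFin x)) (∈-allFin y)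
... | true | xy-respected = xy-respected

isWR-complete : ∀ {n} A (φ : Fin n → Colour) → IsWR A φ → isWR A φ ≡ true
isWR-complete {n} A φ valid =
  all-complete _ (allFin n) (λ x → all-complete _ (allFin n) (λ y → respected x y))
  where
  respected : ∀ x y → not (A x y) ∨ P3°-adj (φ x) (φ y) ≡ true
  respected x y with A x y in Axy
  ... | true  = valid x y Axy
  ... | false = refl

isWR-resp : ∀ {n} A {φ ψ : Fin n → Colour} → (∀ i → φ i ≡ ψ i) → isWR A φ ≡ true → isWR A ψ ≡ true
isWR-resp A {φ} {ψ} φ≈ψ valid = isWR-complete A ψ (λ x y Axy →
  subst₂ (λ c d → P3°-adj c d ≡ true) (φ≈ψ x) (φ≈ψ y) (isWR-sound A φ valid x y Axy))

samePair-sound : ∀ {n} {s t x y : Fin n} → samePair s t x y ≡ true → (x ≡ s × y ≡ t) ⊎ (x ≡ t × y ≡ s)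
samePair-sound {s = s} {t} {x} {y} same with x ≟ s | y ≟ t | x ≟ t | y ≟ s
... | yes x≡s | yes y≡t | _       | _       = inj₁ (x≡s , y≡t)
... | yes _   | no _    | yes x≡t | yes y≡s = inj₂ (x≡t , y≡s)
... | no _    | _       | yes x≡t | yes y≡s = inj₂ (x≡t , y≡s)

IsWR-insert : ∀ {n} (H : SimpleGraph n) (e : Edge H) (φ : Fin n → Colour) →
  IsWR (adj H) φ ⇔ (IsWR (delAdj H e) φ × P3°-adj (φ (u e)) (φ (v e)) ≡ true)
IsWR-insert H e φ = mk⇔ restrict extend
  where
  restrict : IsWR (adj H) φ → IsWR (delAdj H e) φ × P3°-adj (φ (u e)) (φ (v e)) ≡ true
  restrict valid = (λ x y del → valid x y (proj₁ (∧-true del))) , valid (u e) (v e) (adjacent e)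

  kept : ∀ {x y} → adj H x y ≡ true → samePair (u e) (v e) x y ≡ false → delAdj H e x y ≡ true
  kept Hxy same rewrite Hxy | same = refl

  extend : IsWR (delAdj H e) φ × P3°-adj (φ (u e)) (φ (v e)) ≡ true → IsWR (adj H) φ
  extend (valid , uv) x y Hxy with samePair (u e) (v e) x y in same
  ... | false = valid x y (kept Hxy same)
  ... | true with samePair-sound {s = u e} {v e} {x} {y} same
  ...   | inj₁ (refl , refl) = uv
  ...   | inj₂ (refl , refl) = trans (P₃°-sym (φ (v e)) (φ (u e))) uv

isWR-insert : ∀ {n} (H : SimpleGraph n) (e : Edge H) (φ : Fin n → Colour) →
  isWR (adj H) φ ≡ true ⇔ (isWR (delAdj H e) φ ≡ true × P3°-adj (φ (u e)) (φ (v e)) ≡ true)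
isWR-insert H e φ = mk⇔
  (λ valid → let valid′ , uv = Equivalence.to (IsWR-insert H e φ) (isWR-sound (adj H) φ valid)
          in isWR-complete (delAdj H e) φ valid′ , uv)
  (λ (valid , uv) → isWR-complete (adj H) φ
    (Equivalence.from (IsWR-insert H e φ) (isWR-sound (delAdj H e) φ valid , uv)))

module _ {n : ℕ} {p} {P : Pred (Fin n) p} (P? : Decidable P) where

  subset : Subset n
  subset = tabulate (does ∘ P?)

  ∈-subset⁺ : ∀ {x} → P x → x ∈ₛ subset
  ∈-subset⁺ {x} Px =
    lookup⇒[]= x subset (trans (lookup∘tabulate (does ∘ P?) x) (dec-true (P? x) Px))

  ∈-subset⁻ : ∀ {x} → x ∈ₛ subset → P x
  ∈-subset⁻ {x} x∈ with P? x | trans (sym (lookup∘tabulate (does ∘ P?) x)) ([]=⇒lookup x∈)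
  ... | yes Px | _ = Px

-- Iterating an inflationary operator on subsets of Fin n reaches a fixed point
-- within n + 1 steps: every step that is not yet a fixed point enlarges the
-- subset, whose size is at most n.
module Closure {n : ℕ} (grow : Subset n → Subset n) (inflationary : ∀ p → p ⊆ grow p) where

  iterate : ℕ → Subset n → Subset n
  iterate zero    p = p
  iterate (suc k) p with p ⊂? grow p
  ... | yes _ = iterate k (grow p)
  ... | no  _ = p

  fixed-unless-strict : ∀ p → ¬ (p ⊂ grow p) → grow p ≡ p
  fixed-unless-strict p not-strict = ⊆-antisym shrinks (inflationary p)
    where
    shrinks : grow p ⊆ p
    shrinks {x} x∈ with x ∈? p
    ... | yes x∈p = x∈p
    ... | no  x∉p = ⊥-elim (not-strict (inflationary p , x , x∈ , x∉p))

  iterate-fixed : ∀ k p → n < k + ∣ p ∣ → grow (iterate k p) ≡ iterate k p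
  iterate-fixed zero    p n<∣p∣ = ⊥-elim (<⇒≱ n<∣p∣ (∣p∣≤n p))
  iterate-fixed (suc k) p bound with p ⊂? grow p
  ... | yes strict     = iterate-fixed k (grow p) (<-≤-trans bound (+-monoʳ-< k (p⊂q⇒∣p∣<∣q∣ strict)))
  ... | no  not-strict = fixed-unless-strict p not-strict

  iterate-invariant : (I : Subset n → Set) → (∀ p → I p → I (grow p)) → ∀ k p → I p → I (iterate k p)
  iterate-invariant I step zero    p Ip = Ip
  iterate-invariant I step (suc k) p Ip with p ⊂? grow p
  ... | yes _ = iterate-invariant I step k (grow p) (step p Ip)
  ... | no  _ = Ip

  closure : Subset n → Subset n
  closure = iterate (suc n)

  closure-fixed : ∀ p → grow (closure p) ≡ closure p
  closure-fixed p = iterate-fixed (suc n) p (s≤s (m≤m+n n ∣ p ∣))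

module _ {n : ℕ} (w : Fin n) where

  whiten : (Fin n → Colour) → Fin n → Colour
  whiten φ x with x ≟ w
  ... | yes _ = white
  ... | no  _ = φ x

  whiten-at : ∀ φ → whiten φ w ≡ white
  whiten-at φ with w ≟ w
  ... | yes _   = refl
  ... | no  w≢w = ⊥-elim (w≢w refl)

  whiten-elsewhere : ∀ φ {x} → x ≢ w → whiten φ x ≡ φ x
  whiten-elsewhere φ {x} x≢w with x ≟ w
  ... | yes x≡w = ⊥-elim (x≢w x≡w)
  ... | no  _   = refl

  whiten-valid : ∀ A {φ} → IsWR A φ → IsWR A (whiten φ)
  whiten-valid A {φ} valid x y Axy with x ≟ w | y ≟ w
  ... | yes _ | _     = white-adjacent (whiten φ y)
  ... | no _  | yes _ = adjacent-white (φ x)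
  ... | no _  | no _  = valid x y Axy

  whiten-injective : ∀ {φ ψ} → φ w ≡ ψ w → (∀ x → whiten φ x ≡ whiten ψ x) → ∀ x → φ x ≡ ψ x
  whiten-injective {φ} {ψ} at-w eq x with x ≟ w
  ... | yes refl = at-w
  ... | no  x≢w  = trans (sym (whiten-elsewhere φ x≢w)) (trans (eq x) (whiten-elsewhere ψ x≢w))

-- The component of a colouring φ is the set of vertices reachable
-- from root through non-white vertices, moving along A in either direction.
module Kempe {n : ℕ} (A : Fin n → Fin n → Bool) (root : Fin n) where

  Linked : Fin n → Fin n → Set
  Linked x y = A x y ≡ true ⊎ A y x ≡ true

  linked? : ∀ x y → Dec (Linked x y)
  linked? x y = (A x y ≟ᵇ true) ⊎-dec (A y x ≟ᵇ true)

  linked-adjacent : ∀ {φ} → IsWR A φ → ∀ {x y} → Linked x y → P3°-adj (φ x) (φ y) ≡ true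
  linked-adjacent     valid {x} {y} (inj₁ Axy) = valid x y Axy
  linked-adjacent {φ} valid {x} {y} (inj₂ Ayx) = trans (P₃°-sym (φ x) (φ y)) (valid y x Ayx)

  nonwhite? : (φ : Fin n → Colour) → Decidable (λ x → φ x ≢ white)
  nonwhite? φ x = ¬? (φ x ≟ white)

  nonwhite : (Fin n → Colour) → Subset n
  nonwhite φ = subset (nonwhite? φ)

  neighbour? : (S : Subset n) → Decidable (λ y → ∃ λ x → x ∈ₛ S × Linked x y)
  neighbour? S y = any? (λ x → (x ∈? S) ×-dec linked? x y)

  neighbours : Subset n → Subset n
  neighbours S = subset (neighbour? S)

  grow : Subset n → Subset n → Subset n
  grow W S = S ∪ (W ∩ neighbours S)

  module Reach (W : Subset n) = Closure (grow W) (λ S → p⊆p∪q (W ∩ neighbours S))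

  component : (Fin n → Colour) → Subset n
  component φ = Reach.closure (nonwhite φ) ⁅ root ⁆

  root∈component : ∀ φ → root ∈ₛ component φ
  root∈component φ =
    Reach.iterate-invariant (nonwhite φ) (root ∈ₛ_) (λ S → p⊆p∪q _) (suc n) ⁅ root ⁆ (x∈⁅x⁆ root)

  component-closed : ∀ φ {x y} → x ∈ₛ component φ → Linked x y → φ y ≢ white → y ∈ₛ component φ
  component-closed φ {x} {y} x∈ link y≢white =
    subst (y ∈ₛ_) (Reach.closure-fixed (nonwhite φ) ⁅ root ⁆)
      (x∈p∪q⁺ (inj₂ (x∈p∩q⁺ ( ∈-subset⁺ (nonwhite? φ) y≢white
                              , ∈-subset⁺ (neighbour? (component φ)) (x , x∈ , link)))))

  outside-white : ∀ φ {x y} → x ∈ₛ component φ → y ∉ₛ component φ → Linked x y → φ y ≡ white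
  outside-white φ {y = y} x∈ y∉ link with φ y ≟ white
  ... | yes y≡white = y≡white
  ... | no  y≢white = ⊥-elim (y∉ (component-closed φ x∈ link y≢white))

  component-colour : ∀ {φ} → IsWR A φ → φ root ≢ white → ∀ {x} → x ∈ₛ component φ → φ x ≡ φ root
  component-colour {φ} valid root≢white =
    Reach.iterate-invariant (nonwhite φ) Coloured step (suc n) ⁅ root ⁆
      (λ x∈ → cong φ (x∈⁅y⁆⇒x≡y root x∈))
    where
    Coloured : Subset n → Set
    Coloured S = ∀ {x} → x ∈ₛ S → φ x ≡ φ root

    step : ∀ S → Coloured S → Coloured (grow (nonwhite φ) S)
    step S coloured {y} y∈ with x∈p∪q⁻ S _ y∈
    ... | inj₁ y∈S = coloured y∈S
    ... | inj₂ y∈new with x∈p∩q⁻ (nonwhite φ) (neighbours S) y∈new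
    ...   | y∈W , y∈N with ∈-subset⁻ (neighbour? S) y∈N
    ...     | x , x∈S , link = trans (sym x≡y) (coloured x∈S)
      where
      x≡y : φ x ≡ φ y
      x≡y = nonwhite-adjacent (subst (_≢ white) (sym (coloured x∈S)) root≢white)
                              (∈-subset⁻ (nonwhite? φ) y∈W) (linked-adjacent valid link)

  component-resp : ∀ {φ ψ} → (∀ x → (φ x ≡ white) ⇔ (ψ x ≡ white)) → component φ ≡ component ψ
  component-resp {φ} {ψ} same-white =
    cong (λ W → Reach.closure W ⁅ root ⁆)
      (tabulate-cong (λ x → cong not (does-⇔ (same-white x) (φ x ≟ white) (ψ x ≟ white))))

  mirrorOn : Subset n → (Fin n → Colour) → Fin n → Colour
  mirrorOn S φ x with x ∈? S
  ... | yes _ = mirror (φ x)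
  ... | no  _ = φ x

  mirrorOn-∈ : ∀ {S φ x} → x ∈ₛ S → mirrorOn S φ x ≡ mirror (φ x)
  mirrorOn-∈ {S} {φ} {x} x∈ with x ∈? S
  ... | yes _  = refl
  ... | no  x∉ = ⊥-elim (x∉ x∈)

  mirrorOn-∉ : ∀ {S φ x} → x ∉ₛ S → mirrorOn S φ x ≡ φ x
  mirrorOn-∉ {S} {φ} {x} x∉ with x ∈? S
  ... | yes x∈ = ⊥-elim (x∉ x∈)
  ... | no  _  = refl

  mirrorOn-cong : ∀ S {φ ψ} x → φ x ≡ ψ x → mirrorOn S φ x ≡ mirrorOn S ψ x
  mirrorOn-cong S x eq with x ∈? S
  ... | yes _ = cong mirror eq
  ... | no  _ = eq

  mirrorOn-involutive : ∀ S φ x → mirrorOn S (mirrorOn S φ) x ≡ φ x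
  mirrorOn-involutive S φ x with x ∈? S
  ... | yes x∈ = trans (cong mirror (mirrorOn-∈ x∈)) (mirror-involutive (φ x))
  ... | no  x∉ = mirrorOn-∉ x∉

  mirrorOn-white : ∀ S φ x → (mirrorOn S φ x ≡ white) ⇔ (φ x ≡ white)
  mirrorOn-white S φ x with x ∈? S
  ... | yes _ = mirror-white (φ x)
  ... | no  _ = mk⇔ id id

  kempe : (Fin n → Colour) → Fin n → Colour
  kempe φ = mirrorOn (component φ) φ

  component-kempe : ∀ φ → component (kempe φ) ≡ component φ
  component-kempe φ = component-resp (mirrorOn-white (component φ) φ)

  kempe-cong : ∀ {φ ψ} → (∀ x → φ x ≡ ψ x) → ∀ x → kempe φ x ≡ kempe ψ x
  kempe-cong {φ} {ψ} φ≈ψ x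
    rewrite component-resp {φ} {ψ} (λ y → mk⇔ (trans (sym (φ≈ψ y))) (trans (φ≈ψ y))) =
    mirrorOn-cong (component ψ) x (φ≈ψ x)

  kempe-involutive : ∀ φ x → kempe (kempe φ) x ≡ φ x
  kempe-involutive φ x rewrite component-kempe φ = mirrorOn-involutive (component φ) φ x

  kempe-injective : ∀ {φ ψ} → (∀ x → kempe φ x ≡ kempe ψ x) → ∀ x → φ x ≡ ψ x
  kempe-injective {φ} {ψ} eq x =
    trans (sym (kempe-involutive φ x)) (trans (kempe-cong eq x) (kempe-involutive ψ x))

  -- Edges inside or outside the component are respected since mirror is an
  -- automorphism; an edge leaving the component ends in a white vertex.
  kempe-valid : ∀ {φ} → IsWR A φ → φ root ≢ white → IsWR A (kempe φ)
  kempe-valid {φ} valid root≢white x y Axy = by-cases (x ∈? component φ) (y ∈? component φ)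
    where
    adjacent-via : ∀ {c d} → kempe φ x ≡ c → kempe φ y ≡ d → P3°-adj c d ≡ true →
      P3°-adj (kempe φ x) (kempe φ y) ≡ true
    adjacent-via refl refl cd = cd

    by-cases : Dec (x ∈ₛ component φ) → Dec (y ∈ₛ component φ) →
      P3°-adj (kempe φ x) (kempe φ y) ≡ true
    by-cases (yes x∈) (yes y∈) =
      adjacent-via (mirrorOn-∈ x∈) (mirrorOn-∈ y∈) (trans (P₃°-mirror (φ x) (φ y)) (valid x y Axy))
    by-cases (no x∉)  (no y∉)  = adjacent-via (mirrorOn-∉ x∉) (mirrorOn-∉ y∉) (valid x y Axy)
    by-cases (yes x∈) (no y∉)  =
      adjacent-via refl (trans (mirrorOn-∉ y∉) (outside-white φ x∈ y∉ (inj₁ Axy)))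
        (adjacent-white (kempe φ x))
    by-cases (no x∉)  (yes y∈) =
      adjacent-via (trans (mirrorOn-∉ x∉) (outside-white φ y∈ x∉ (inj₂ Axy))) refl
        (white-adjacent (kempe φ y))

  kempe-at-root : ∀ φ → kempe φ root ≡ mirror (φ root)
  kempe-at-root φ = mirrorOn-∈ (root∈component φ)

  kempe-elsewhere : ∀ {φ} → IsWR A φ → φ root ≢ white → ∀ {x} → φ x ≢ φ root → kempe φ x ≡ φ x
  kempe-elsewhere valid root≢white x≢root = mirrorOn-∉ (x≢root ∘ component-colour valid root≢white)

module Classes {n : ℕ} (A : Fin n → Fin n → Bool) (s t : Fin n) where

  InClass : Colour → Colour → (Fin n → Colour) → Set
  InClass c d φ = isWR A φ ≡ true × φ s ≡ c × φ t ≡ d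

  inClass? : ∀ c d → Decidable (InClass c d)
  inClass? c d φ = (isWR A φ ≟ᵇ true) ×-dec ((φ s ≟ c) ×-dec (φ t ≟ d))

  N : Colour → Colour → ℕ
  N c d = count (inClass? c d) (allMaps n)

  InClass-resp : ∀ {c d} {φ ψ : Fin n → Colour} → (∀ x → φ x ≡ ψ x) → InClass c d φ → InClass c d ψ
  InClass-resp φ≈ψ (valid , at-s , at-t) =
    isWR-resp A φ≈ψ valid , trans (sym (φ≈ψ s)) at-s , trans (sym (φ≈ψ t)) at-t

  N-≤-by-injection : ∀ {c d c′ d′} (f : (Fin n → Colour) → Fin n → Colour) →
    (∀ {φ} → InClass c d φ → InClass c′ d′ (f φ)) →
    (∀ {φ ψ} → InClass c d φ → InClass c d ψ → (∀ x → f φ x ≡ f ψ x) → ∀ x → φ x ≡ ψ x) →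
    N c d ≤ N c′ d′
  N-≤-by-injection {c} {d} {c′} {d′} =
    Counting.count-≤-by-injection (maps n Colour) (allMaps-unique n) (allMaps-complete n)
      (inClass? c d) (inClass? c′ d′) InClass-resp InClass-resp

  module _ (s≢t : s ≢ t) where

    N-whiten-t : ∀ {c d} → N c d ≤ N c white
    N-whiten-t = N-≤-by-injection (whiten t)
      (λ {φ} (valid , at-s , _) →
          isWR-complete A _ (whiten-valid t A (isWR-sound A φ valid))
        , trans (whiten-elsewhere t φ s≢t) at-s
        , whiten-at t φ)
      (λ (_ , _ , φt) (_ , _ , ψt) → whiten-injective t (trans φt (sym ψt)))

    N-whiten-s : ∀ {c d} → N c d ≤ N white d
    N-whiten-s = N-≤-by-injection (whiten s)
      (λ {φ} (valid , _ , at-t) →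
          isWR-complete A _ (whiten-valid s A (isWR-sound A φ valid))
        , whiten-at s φ
        , trans (whiten-elsewhere s φ (s≢t ∘ sym)) at-t)
      (λ (_ , φs , _) (_ , ψs , _) → whiten-injective s (trans φs (sym ψs)))

    -- The Kempe chain at t maps class (c , d) injectively into (c , mirror d); it
    -- keeps the colour c of s because c differs from the colour d of the root t.
    N-kempe : ∀ {c d} → d ≢ white → c ≢ d → N c d ≤ N c (mirror d)
    N-kempe {c} {d} d≢white c≢d = N-≤-by-injection kempe moves (λ _ _ → kempe-injective)
      where
      open Kempe A t using (kempe; kempe-valid; kempe-at-root; kempe-elsewhere; kempe-injective)

      moves : ∀ {φ} → InClass c d φ → InClass c (mirror d) (kempe φ)
      moves {φ} (valid , refl , refl) =
          isWR-complete A _ (kempe-valid (isWR-sound A φ valid) d≢white)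
        , kempe-elsewhere (isWR-sound A φ valid) d≢white c≢d
        , kempe-at-root φ

colourPairs adjacentPairs : List (Colour × Colour)
colourPairs =
  (red , red) ∷ (red , white) ∷ (red , blue) ∷ (white , red) ∷ (white , white) ∷
  (white , blue) ∷ (blue , red) ∷ (blue , white) ∷ (blue , blue) ∷ []
adjacentPairs =
  (red , red) ∷ (red , white) ∷ (white , red) ∷ (white , white) ∷
  (white , blue) ∷ (blue , white) ∷ (blue , blue) ∷ []

pairIndicator : Bool → Colour → Colour → Colour × Colour → ℕ
pairIndicator w c₁ c₂ (c , d) = indicator (w ∧ (does (c₁ ≟ c) ∧ does (c₂ ≟ d)))

colourPairs-partition : ∀ w c₁ c₂ → indicator w ≡ sum (map (pairIndicator w c₁ c₂) colourPairs)
colourPairs-partition false _                _                = refl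
colourPairs-partition true  zero             zero             = refl
colourPairs-partition true  zero             (suc zero)       = refl
colourPairs-partition true  zero             (suc (suc zero)) = refl
colourPairs-partition true  (suc zero)       zero             = refl
colourPairs-partition true  (suc zero)       (suc zero)       = refl
colourPairs-partition true  (suc zero)       (suc (suc zero)) = refl
colourPairs-partition true  (suc (suc zero)) zero             = refl
colourPairs-partition true  (suc (suc zero)) (suc zero)       = refl
colourPairs-partition true  (suc (suc zero)) (suc (suc zero)) = refl

adjacentPairs-partition : ∀ w c₁ c₂ →
  indicator (w ∧ does (P3°-adj c₁ c₂ ≟ᵇ true)) ≡ sum (map (pairIndicator w c₁ c₂) adjacentPairs)
adjacentPairs-partition false _                _                = refl
adjacentPairs-partition true  zero             zero             = refl
adjacentPairs-partition true  zero             (suc zero)       = refl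
adjacentPairs-partition true  zero             (suc (suc zero)) = refl
adjacentPairs-partition true  (suc zero)       zero             = refl
adjacentPairs-partition true  (suc zero)       (suc zero)       = refl
adjacentPairs-partition true  (suc zero)       (suc (suc zero)) = refl
adjacentPairs-partition true  (suc (suc zero)) zero             = refl
adjacentPairs-partition true  (suc (suc zero)) (suc zero)       = refl
adjacentPairs-partition true  (suc (suc zero)) (suc (suc zero)) = refl

module EdgeClasses {n : ℕ} (H : SimpleGraph n) (e : Edge H) where
  open Classes (delAdj H e) (u e) (v e) public

  classSize : Colour × Colour → ℕ
  classSize (c , d) = N c d

  wr-minus-classes : wr-minus H e ≡ sum (map classSize colourPairs)
  wr-minus-classes =
    count-partition (λ φ → isWR (delAdj H e) φ ≟ᵇ true) colourPairs (λ (c , d) → inClass? c d)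
      (λ φ → colourPairs-partition _ (φ (u e)) (φ (v e))) (allMaps n)

  wr-classes : wr H ≡ sum (map classSize adjacentPairs)
  wr-classes =
    count-partition (λ φ → isWR (adj H) φ ≟ᵇ true) adjacentPairs (λ (c , d) → inClass? c d)
      (λ φ → trans (cong indicator (edge-test φ)) (adjacentPairs-partition _ (φ (u e)) (φ (v e))))
      (allMaps n)
    where
    edge-test : ∀ φ → does (isWR (adj H) φ ≟ᵇ true)
                      ≡ does ((isWR (delAdj H e) φ ≟ᵇ true) ×-dec (P3°-adj (φ (u e)) (φ (v e)) ≟ᵇ true))
    edge-test φ = does-⇔ (isWR-insert H e φ) (isWR (adj H) φ ≟ᵇ true)
      ((isWR (delAdj H e) φ ≟ᵇ true) ×-dec (P3°-adj (φ (u e)) (φ (v e)) ≟ᵇ true))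

seven-ninths : ∀ s W → 7 * s ≤ 2 * W → 7 * (s + W) ≤ 9 * W
seven-ninths s W 7s≤2W = begin
  7 * (s + W)   ≡⟨ *-distribˡ-+ 7 s W ⟩
  7 * s + 7 * W ≤⟨ +-monoˡ-≤ (7 * W) 7s≤2W ⟩
  2 * W + 7 * W ≡⟨ *-distribʳ-+ W 2 7 ⟨
  9 * W         ∎
  where open ≤-Reasoning

class-bound : ∀ RR RW RB WR WW WB BR BW BB →
  RB + BR ≤ RR + BB → RB + BR ≤ RW + BW → RB + BR ≤ WB + WR → RB + BR ≤ WW + WW →
  7 * (RR + (RW + (RB + (WR + (WW + (WB + (BR + (BW + (BB + 0)))))))))
    ≤ 9 * (RR + (RW + (WR + (WW + (WB + (BW + (BB + 0)))))))
class-bound RR RW RB WR WW WB BR BW BB ≤RR+BB ≤RW+BW ≤WB+WR ≤WW+WW = begin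
  7 * (RR + (RW + (RB + (WR + (WW + (WB + (BR + (BW + (BB + 0)))))))))
    ≡⟨ cong (7 *_) (separate-excluded RR RW RB WR WW WB BR BW BB) ⟩
  7 * (RB + BR + W)
    ≤⟨ seven-ninths (RB + BR) W 7s≤2W ⟩
  9 * W ∎
  where
  open ≤-Reasoning
  W : ℕ
  W = RR + (RW + (WR + (WW + (WB + (BW + (BB + 0))))))

  separate-excluded : ∀ RR RW RB WR WW WB BR BW BB →
    RR + (RW + (RB + (WR + (WW + (WB + (BR + (BW + (BB + 0))))))))
      ≡ RB + BR + (RR + (RW + (WR + (WW + (WB + (BW + (BB + 0)))))))
  separate-excluded = solve-∀

  seven : ∀ s → 7 * s ≡ 2 * s + 2 * s + 2 * s + s
  seven = solve-∀

  regroup : ∀ RR RW WR WW WB BW BB →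
    2 * (RR + BB) + 2 * (RW + BW) + 2 * (WB + WR) + (WW + WW)
      ≡ 2 * (RR + (RW + (WR + (WW + (WB + (BW + (BB + 0)))))))
  regroup = solve-∀

  7s≤2W : 7 * (RB + BR) ≤ 2 * W
  7s≤2W = begin
    7 * (RB + BR)
      ≡⟨ seven (RB + BR) ⟩
    2 * (RB + BR) + 2 * (RB + BR) + 2 * (RB + BR) + (RB + BR)
      ≤⟨ +-mono-≤ (+-mono-≤ (+-mono-≤ (*-monoʳ-≤ 2 ≤RR+BB) (*-monoʳ-≤ 2 ≤RW+BW)) (*-monoʳ-≤ 2 ≤WB+WR))
                   ≤WW+WW ⟩
    2 * (RR + BB) + 2 * (RW + BW) + 2 * (WB + WR) + (WW + WW)
      ≡⟨ regroup RR RW WR WW WB BW BB ⟩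
    2 * W ∎

endpoints-distinct : ∀ {n} (H : SimpleGraph n) (e : Edge H) → u e ≢ v e
endpoints-distinct H e u≡v
  with () ← trans (sym (adjacent e)) (trans (cong (λ x → adj H x (v e)) u≡v) (loopless H (v e)))

theorem1p5 : ∀ (n : ℕ) (H : SimpleGraph n) (e : Edge H) →
    7 * wr-minus H e ≤ 9 * wr H
theorem1p5 n H e = begin
  7 * wr-minus H e                      ≡⟨ cong (7 *_) wr-minus-classes ⟩
  7 * sum (map classSize colourPairs)   ≤⟨ class-bound (N red red) (N red white) (N red blue)
                                                       (N white red) (N white white) (N white blue)
                                                       (N blue red) (N blue white) (N blue blue)
                                                       RB+BR≤RR+BB RB+BR≤RW+BW RB+BR≤WB+WR RB+BR≤WW+WW ⟩
  9 * sum (map classSize adjacentPairs) ≡⟨ cong (9 *_) wr-classes ⟨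
  9 * wr H                              ∎
  where
  open ≤-Reasoning
  open EdgeClasses H e

  u≢v : u e ≢ v e
  u≢v = endpoints-distinct H e

  RB+BR≤RR+BB : N red blue + N blue red ≤ N red red + N blue blue
  RB+BR≤RR+BB = +-mono-≤ (N-kempe u≢v (λ ()) (λ ())) (N-kempe u≢v (λ ()) (λ ()))

  RB+BR≤RW+BW : N red blue + N blue red ≤ N red white + N blue white
  RB+BR≤RW+BW = +-mono-≤ (N-whiten-t u≢v) (N-whiten-t u≢v)

  RB+BR≤WB+WR : N red blue + N blue red ≤ N white blue + N white red
  RB+BR≤WB+WR = +-mono-≤ (N-whiten-s u≢v) (N-whiten-s u≢v)

  RB+BR≤WW+WW : N red blue + N blue red ≤ N white white + N white white
  RB+BR≤WW+WW = +-mono-≤ via-white via-white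
    where
    via-white : ∀ {c} → N c (mirror c) ≤ N white white
    via-white = ≤-trans (N-whiten-s u≢v) (N-whiten-t u≢v)
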